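{- Let $n\ge4$ and let $\Gamma$ be a connected simple graph on the $n-1$ vertices $\{2,\dots,n\}$. Then $\pi_\Gamma(\mathcal{M}_{0,n}^{\mathrm{rad}})=B'(\Gamma)$, where $\mathcal{M}_{0,n}^{\mathrm{rad}}$ is identified with $B'(K_{n-1})\subseteq\mathbb{R}^{|E(K_{n-1})|}/L$ via $\Psi$, and $\mathbb{R}^{|E(K_{n-1})|}/L/S$ is identified with $\mathbb{R}^{|E(\Gamma)|}/L$.
   Context: Rational $n$-marked tropical curves: metric trees with ends labeled $1,\dots,n$, bounded edges of positive length, vertices of valence $\ge3$. The root vertex $v_0$ carries end $1$. A radially aligned combinatorial type is the combinatorial type (tree with labeled ends, lengths forgotten) together with the weak ordering of vertices by distance from $v_0$; $\mathcal{M}_{0,n}^{\mathrm{rad}}$ is the cone complex of radially aligned curves, a refinement of the usual tropical moduli space $\mathcal{M}_{0,n}^{\mathrm{trop}}$. For a graph $G$ with edge set $E$, flats of its cycle matroid are edge sets $F$ such that adding any edge outside $F$ increases the rank (rank = number of non-isolated vertices minus number of components among them). $B'(G)\subseteq\mathbb{R}^{|E|}/L$, $L=\mathbb{R}(1,\dots,1)$, is the union of the cones spanned by $\rho_{F_1},\dots,\rho_{F_r}$ over chains of flats $\emptyset\subsetneq F_1\subsetneq\cdots\subsetneq F_r\subsetneq E$, where $\rho_F=-\sum_{e\in F}v_e$. The flats of $K_{n-1}$ (on vertex set $\{2,\dots,n\}$) are the cluster graphs $\coprod_j K_{I_j}$. There is a linear isomorphism $\Psi$ from the ambient space $Q_n=\mathbb{R}^{\binom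 n2}/\Phi(\mathbb{R}^n)$ of $\mathcal{M}_{0,n}^{\mathrm{rad}}$ to $\mathbb{R}^{|E(K_{n-1})|}/L$ identifying $\mathcal{M}_{0,n}^{\mathrm{rad}}$ with $B'(K_{n-1})$ as fans, sending the type of a curve with $d$ bounded edges of equal length from the root to vertices with end sets $I_1,\dots,I_d$ to the flat $\coprod_jK_{I_j}$. Let $S=\mathrm{span}\{v_e: e\in E(K_{n-1})\setminus E(\Gamma)\}$ and $\pi_\Gamma:\mathbb{R}^{|E(K_{n-1})|}/L\to\mathbb{R}^{|E(K_{n-1})|}/L/S$ the projection forgetting coordinates of edges not in $\Gamma$; the target is naturally isomorphic to $\mathbb{R}^{|E(\Gamma)|}/L$.
   Formalization: The ambient spaces $\mathbb{R}^{|E(K_{n-1})|}/L$ and $\mathbb{R}^{|E(\Gamma)|}/L$ are taken over ℚ instead of ℝ, and the coefficients spanning the cones of $B'(\Gamma)$ and $B'(K_{n-1})$ are rational. -}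

module Defs where

open import Data.Bool using (Bool; true; false; _∧_; _∨_; not; if_then_else_)
open import Data.Nat using (ℕ; zero; suc; _∸_; _<_; _≤_; _<ᵇ_)
open import Data.Fin using (Fin; toℕ) renaming (_<_ to _<F_)
import Data.Fin as F
open import Data.Fin.Properties using (_<?_; _≟_)
open import Data.Product using (Σ; ∃; _×_; _,_; proj₁; proj₂; Σ-syntax)
open import Data.List using (List; []; _∷_; map)
open import Data.List.Relation.Unary.All using (All)
open import Data.Unit using (⊤)
open import Relation.Nullary.Decidable using (⌊_⌋; yes; no)
open import Relation.Binary.PropositionalEquality using (_≡_)
open import Relation.Binary.Construct.Closure.ReflexiveTransitive using (Star)
open import Data.Rational using (ℚ; 0ℚ; 1ℚ; _+_; _*_; -_) renaming (_≤_ to _≤ℚ_)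

-- Vertices of K_m are Fin m (for m = n-1, index i stands for vertex i+2).
-- Edges of K_m: unordered pairs {i,j}, represented as (i , j , i<j).

Edge : ℕ → Set
Edge m = Σ (Fin m) λ i → Σ (Fin m) λ j → i <F j

-- Edge sets (= simple graphs on the vertex set Fin m, as subgraphs of K_m).
EdgeSet : ℕ → Set
EdgeSet m = Edge m → Bool

allEdges : ∀ {m} → EdgeSet m
allEdges _ = true

noEdges : ∀ {m} → EdgeSet m
noEdges _ = false

_∈E_ : ∀ {m} → Edge m → EdgeSet m → Set
e ∈E F = F e ≡ true

_⊆E_ : ∀ {m} → EdgeSet m → EdgeSet m → Set
F ⊆E G = ∀ e → e ∈E F → e ∈E G

_⊊E_ : ∀ {m} → EdgeSet m → EdgeSet m → Set
F ⊊E G = F ⊆E G × ∃ λ e → (e ∈E G) × (F e ≡ false)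

sameEdge : ∀ {m} → Edge m → Edge m → Bool
sameEdge (i , j , _) (i' , j' , _) = ⌊ i ≟ i' ⌋ ∧ ⌊ j ≟ j' ⌋

insertE : ∀ {m} → Edge m → EdgeSet m → EdgeSet m
insertE e F e' = F e' ∨ sameEdge e' e

adj : ∀ {m} → EdgeSet m → Fin m → Fin m → Bool
adj F u v with u <? v
... | yes p = F (u , v , p)
... | no _ with v <? u
...   | yes q = F (v , u , q)
...   | no _ = false

anyFin : ∀ {m} → (Fin m → Bool) → Bool
anyFin {zero} p = false
anyFin {suc m} p = p F.zero ∨ anyFin (λ i → p (F.suc i))

countFin : ∀ {m} → (Fin m → Bool) → ℕ
countFin {zero} p = 0
countFin {suc m} p = (if p F.zero then 1 else 0) Data.Nat.+ countFin (λ i → p (F.suc i))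

-- Rank of the cycle matroid:
--   rank F = #(non-isolated vertices of F) − #(connected components among them)

reachB : ∀ {m} → EdgeSet m → ℕ → Fin m → Fin m → Bool
reachB F zero u v = ⌊ u ≟ v ⌋
reachB F (suc k) u v = reachB F k u v ∨ anyFin (λ w → reachB F k u w ∧ adj F w v)

-- connected in F (paths have at most m edges)
connB : ∀ {m} → EdgeSet m → Fin m → Fin m → Bool
connB {m} F = reachB F m

nonIsolated : ∀ {m} → EdgeSet m → Fin m → Bool
nonIsolated F v = anyFin (λ u → adj F v u)

numNonIsolated : ∀ {m} → EdgeSet m → ℕ
numNonIsolated F = countFin (nonIsolated F)

-- each component among non-isolated vertices is counted once, at its least vertex
numComponents : ∀ {m} → EdgeSet m → ℕ
numComponents F =
  countFin (λ v → nonIsolated F v ∧ not (anyFin (λ u → (toℕ u <ᵇ toℕ v) ∧ connB F u v)))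

rank : ∀ {m} → EdgeSet m → ℕ
rank F = numNonIsolated F ∸ numComponents F

IsFlat : ∀ {m} → EdgeSet m → EdgeSet m → Set
IsFlat G F = F ⊆E G × (∀ e → e ∈E G → F e ≡ false → rank F < rank (insertE e F))

Connected : ∀ {m} → EdgeSet m → Set
Connected {m} G = ∀ (u v : Fin m) → Star (λ a b → adj G a b ≡ true) u v

-- B'(G): vectors in ℚ^{E(G)} (represented as functions Edge m → ℚ, only
-- coordinates of edges of G matter), modulo L = ℚ(1,…,1).

Vec : ℕ → Set
Vec m = Edge m → ℚ

ρ : ∀ {m} → EdgeSet m → Vec m
ρ F e = if F e then - 1ℚ else 0ℚ

combo : ∀ {m} → List (ℚ × EdgeSet m) → Vec m
combo [] e = 0ℚ
combo ((λ₁ , F) ∷ cs) e = λ₁ * ρ F e + combo cs e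

ChainFrom : ∀ {m} → EdgeSet m → EdgeSet m → List (EdgeSet m) → Set
ChainFrom G prev [] = ⊤
ChainFrom G prev (F ∷ Fs) = (prev ⊊E F) × IsFlat G F × (F ⊊E G) × ChainFrom G F Fs

InB' : ∀ {m} → EdgeSet m → Vec m → Set
InB' {m} G x =
  Σ[ cs ∈ List (ℚ × EdgeSet m) ]
    ChainFrom G noEdges (map proj₂ cs)
    × All (λ p → 0ℚ ≤ℚ proj₁ p) cs
    × (Σ[ c ∈ ℚ ] ∀ e → e ∈E G → x e ≡ combo cs e + c)

InProjection : ∀ {m} → EdgeSet m → Vec m → Set
InProjection {m} Γ y =
  Σ[ x ∈ Vec m ] InB' (allEdges {m}) x × (Σ[ c ∈ ℚ ] ∀ e → e ∈E Γ → x e ≡ y e + c)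

-- Flats of a graph are exactly the edge sets F containing every edge whose ends are joined by a
-- path in F: rank F is the number of vertices that are not the least vertex of their F-component,
-- and adding an edge raises this number exactly when the edge joins two components.
-- Hence a flat F of Γ extends to the flat of K_m of all pairs joined in F, which meets Γ in F
-- again, so chains of flats of Γ lift to chains of flats of K_m with the same Γ-coordinates.
-- Conversely a proper flat of K_m meets Γ in a flat of Γ, proper because Γ is connected.
-- Restricting a chain may repeat flats or produce empty ones; merging equal neighbours (adding
-- their coefficients) and dropping empty flats (whose ρ vanishes) gives a chain for B'(Γ).

{-# OPTIONS --safe #-}
module Submission where

open import Defs
open import Data.Nat using (ℕ; _≤_; _∸_)
open import Data.Product using (_×_)

open import Data.Bool using (Bool; true; false; _∧_; _∨_; not; if_then_else_)
import Data.Bool.Properties as Bool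
open import Data.Empty using (⊥-elim)
open import Data.Fin using (Fin; toℕ) renaming (_<_ to _<F_)
import Data.Fin as F
open import Data.Fin.Properties using (_<?_; _≟_; <-irrelevant; <-asym; <-cmp; any?; all?; ¬∀⟶∃¬)
open import Data.List using (List; []; _∷_; map)
open import Data.List.Relation.Unary.All as All using (All; []; _∷_)
open import Data.List.Relation.Unary.All.Properties using (map⁺)
open import Data.Nat using (zero; suc; _<_; _<ᵇ_; z≤n; s≤s; _≤′_; ≤′-refl; ≤′-step)
import Data.Nat as N
import Data.Nat.Properties as ℕ
open import Data.Product using (Σ; ∃; _,_; proj₁; proj₂; Σ-syntax; map₂)
open import Data.Rational using (ℚ; 0ℚ; 1ℚ; _+_; _*_; -_) renaming (_≤_ to _≤ℚ_)
import Data.Rational.Properties as ℚ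
open import Data.Sum using (_⊎_; inj₁; inj₂)
open import Data.Unit using (⊤; tt)
open import Function using (_∘_; Equivalence)
open import Relation.Binary using (tri<; tri≈; tri>)
open import Relation.Binary.Construct.Closure.ReflexiveTransitive as Star using (Star; ε; _◅_; _◅◅_; _>>=_)
open import Relation.Binary.PropositionalEquality
  using (_≡_; _≢_; refl; sym; trans; cong; cong₂; subst₂; module ≡-Reasoning)
open import Relation.Nullary using (Dec; yes; no)
open import Relation.Nullary.Decidable using (⌊_⌋; isYes≗does; dec-true; toWitness; map′)

private variable
  m k l : ℕ
  u v w a b : Fin m
  F G H Γ : EdgeSet m

true≢false : true ≢ false
true≢false ()

∧-true : ∀ x y → x ∧ y ≡ true → x ≡ true × y ≡ true
∧-true x y h = Bool.∧-conicalˡ x y h , Bool.∧-conicalʳ x y h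

∨-true : ∀ x {y} → x ∨ y ≡ true → x ≡ true ⊎ y ≡ true
∨-true true  _ = inj₁ refl
∨-true false h = inj₂ h

∨-trueˡ : ∀ {x} y → x ≡ true → x ∨ y ≡ true
∨-trueˡ _ refl = refl

∨-trueʳ : ∀ x {y} → y ≡ true → x ∨ y ≡ true
∨-trueʳ x refl = Bool.∨-zeroʳ x

⇔⇒≡ : ∀ {x y} → (x ≡ true → y ≡ true) → (y ≡ true → x ≡ true) → x ≡ y
⇔⇒≡ {true}          to _    = sym (to refl)
⇔⇒≡ {false} {true}  _  from = from refl
⇔⇒≡ {false} {false} _  _    = refl

≟-refl : (u : Fin m) → ⌊ u ≟ u ⌋ ≡ true
≟-refl u = trans (isYes≗does (u ≟ u)) (dec-true (u ≟ u) refl)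

≟⇒≡ : (x y : Fin m) → ⌊ x ≟ y ⌋ ≡ true → x ≡ y
≟⇒≡ x y h = toWitness {a? = x ≟ y} (Bool.T-≡ .Equivalence.from h)

anyFin-witness : (p : Fin m → Bool) → anyFin p ≡ true → ∃ λ i → p i ≡ true
anyFin-witness {suc m} p h with ∨-true (p F.zero) h
... | inj₁ h₀ = F.zero , h₀
... | inj₂ h₁ with anyFin-witness (p ∘ F.suc) h₁
...   | i , hi = F.suc i , hi

anyFin-intro : (p : Fin m → Bool) (i : Fin m) → p i ≡ true → anyFin p ≡ true
anyFin-intro p F.zero    h = ∨-trueˡ _ h
anyFin-intro p (F.suc i) h = ∨-trueʳ (p F.zero) (anyFin-intro (p ∘ F.suc) i h)

anyFin-cong : {p q : Fin m → Bool} → (∀ i → p i ≡ q i) → anyFin p ≡ anyFin q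
anyFin-cong {zero}  _  = refl
anyFin-cong {suc m} eq = cong₂ _∨_ (eq F.zero) (anyFin-cong (eq ∘ F.suc))

indicator : Bool → ℕ
indicator b = if b then 1 else 0

indicator-mono : ∀ {x y} → (x ≡ true → y ≡ true) → indicator x ≤ indicator y
indicator-mono {true}  x⇒y rewrite x⇒y refl = s≤s z≤n
indicator-mono {false} _ = z≤n

countFin-cong : {p q : Fin m → Bool} → (∀ i → p i ≡ q i) → countFin p ≡ countFin q
countFin-cong {zero}  _  = refl
countFin-cong {suc m} eq = cong₂ (λ b n → indicator b N.+ n) (eq F.zero) (countFin-cong (eq ∘ F.suc))

countFin-mono : {p q : Fin m → Bool} → (∀ i → p i ≡ true → q i ≡ true) → countFin p ≤ countFin q
countFin-mono {zero}  _   = z≤n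
countFin-mono {suc m} p⇒q = ℕ.+-mono-≤ (indicator-mono (p⇒q F.zero)) (countFin-mono (p⇒q ∘ F.suc))

countFin-mono-< : {p q : Fin m → Bool} → (∀ i → p i ≡ true → q i ≡ true) →
  (i : Fin m) → p i ≡ false → q i ≡ true → countFin p < countFin q
countFin-mono-< {suc m} p⇒q F.zero pi qi rewrite pi | qi = s≤s (countFin-mono (p⇒q ∘ F.suc))
countFin-mono-< {suc m} p⇒q (F.suc i) pi qi =
  ℕ.+-mono-≤-< (indicator-mono (p⇒q F.zero)) (countFin-mono-< (p⇒q ∘ F.suc) i pi qi)

countFin-pos : (p : Fin m → Bool) (i : Fin m) → p i ≡ true → 0 < countFin p
countFin-pos p F.zero    h rewrite h = s≤s z≤n
countFin-pos p (F.suc i) h = ℕ.<-≤-trans (countFin-pos (p ∘ F.suc) i h) (ℕ.m≤n+m _ _)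

countFin-bound : (p : Fin m → Bool) → countFin p ≤ m
countFin-bound {zero}  _ = z≤n
countFin-bound {suc m} p = ℕ.+-mono-≤ (indicator≤1 (p F.zero)) (countFin-bound (p ∘ F.suc))
  where
  indicator≤1 : ∀ b → indicator b ≤ 1
  indicator≤1 true  = s≤s z≤n
  indicator≤1 false = z≤n

countFin-split : (p q : Fin m → Bool) →
  countFin p ≡ countFin (λ v → p v ∧ not (q v)) N.+ countFin (λ v → p v ∧ q v)
countFin-split {zero} _ _ = refl
countFin-split {suc m} p q with p F.zero | q F.zero | countFin-split (p ∘ F.suc) (q ∘ F.suc)
... | true  | true  | ih = trans (cong suc ih) (sym (ℕ.+-suc _ _))
... | true  | false | ih = cong suc ih
... | false | true  | ih = ih
... | false | false | ih = ih

least : (p : Fin m → Bool) (x : Fin m) → p x ≡ true →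
  Σ (Fin m) λ r → p r ≡ true × (∀ u → u <F r → p u ≡ false)
least {suc m} p x px with p F.zero in p₀
... | true = F.zero , p₀ , λ _ ()
... | false with x
...   | F.zero   = ⊥-elim (true≢false (trans (sym px) p₀))
...   | F.suc x′ with least (p ∘ F.suc) x′ px
...     | r , pr , below = F.suc r , pr , λ { F.zero _ → p₀ ; (F.suc u) (s≤s u<r) → below u u<r }

any-edge? : (p : Edge m → Bool) → Dec (∃ λ e → p e ≡ true)
any-edge? p =
  map′ (λ (i , j , i<j , h) → (i , j , i<j) , h) (λ ((i , j , i<j) , h) → i , j , i<j , h)
       (any? λ i → any? λ j → edge-at? i j)
  where
  edge-at? : ∀ i j → Dec (Σ (i <F j) λ i<j → p (i , j , i<j) ≡ true)
  edge-at? i j with i <? j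
  ... | no i≮j  = no (i≮j ∘ proj₁)
  ... | yes i<j = map′ (i<j ,_) (λ (i<j′ , h) → trans (cong (λ q → p (i , j , q)) (<-irrelevant i<j i<j′)) h)
                       (p (i , j , i<j) Bool.≟ true)

-- Paths and connectivity

-- A record rather than adj G u v ≡ true, so that u and v can be inferred from the type.
record Adj (G : EdgeSet m) (u v : Fin m) : Set where
  constructor adjacent
  field adj≡true : adj G u v ≡ true

Path : EdgeSet m → Fin m → Fin m → Set
Path G = Star (Adj G)

Joins : Edge m → Fin m → Fin m → Set
Joins (i , j , _) u v = (u ≡ i × v ≡ j) ⊎ (u ≡ j × v ≡ i)

adj-< : (p : a <F b) → adj G a b ≡ G (a , b , p)
adj-< {a = a} {b} {G} p with a <? b
... | yes p′ = cong (λ q → G (a , b , q)) (<-irrelevant p′ p)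
... | no ¬p  = ⊥-elim (¬p p)

adj-> : (p : a <F b) → adj G b a ≡ G (a , b , p)
adj-> {a = a} {b} {G} p with b <? a
... | yes q = ⊥-elim (<-asym p q)
... | no _ with a <? b
...   | yes p′ = cong (λ q → G (a , b , q)) (<-irrelevant p′ p)
...   | no ¬p  = ⊥-elim (¬p p)

edge⇒adj : (e : Edge m) → e ∈E G → Joins e u v → Adj G u v
edge⇒adj (a , b , p) h (inj₁ (refl , refl)) = adjacent (trans (adj-< p) h)
edge⇒adj (a , b , p) h (inj₂ (refl , refl)) = adjacent (trans (adj-> p) h)

adj⇒edge : Adj G u v → ∃ λ e → e ∈E G × Joins e u v
adj⇒edge {u = u} {v} (adjacent h) with u <? v
... | yes p = (u , v , p) , h , inj₁ (refl , refl)
... | no _ with v <? u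
...   | yes q = (v , u , q) , h , inj₂ (refl , refl)
...   | no _  = ⊥-elim (true≢false (sym h))

adj-mono : F ⊆E G → Adj F u v → Adj G u v
adj-mono F⊆G h with adj⇒edge h
... | e , e∈F , joins = edge⇒adj e (F⊆G e e∈F) joins

adj-sym : Adj G u v → Adj G v u
adj-sym h with adj⇒edge h
... | e@(_ , _ , _) , e∈G , inj₁ (refl , refl) = edge⇒adj e e∈G (inj₂ (refl , refl))
... | e@(_ , _ , _) , e∈G , inj₂ (refl , refl) = edge⇒adj e e∈G (inj₁ (refl , refl))

connected⇒path : Connected G → ∀ u v → Path G u v
connected⇒path connected u v = Star.map adjacent (connected u v)

path-mono : F ⊆E G → Path F u v → Path G u v
path-mono F⊆G = Star.map (adj-mono F⊆G)

path-sym : Path G u v → Path G v u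
path-sym = Star.reverse adj-sym

path-along : (e : Edge m) → Joins e u v → Path G (proj₁ e) (proj₁ (proj₂ e)) → Path G u v
path-along _ (inj₁ (refl , refl)) q = q
path-along _ (inj₂ (refl , refl)) q = path-sym q

reach⇒path : ∀ k → reachB G k u v ≡ true → Path G u v
reach⇒path {u = u} {v} zero h with u ≟ v
... | yes refl = ε
... | no _     = ⊥-elim (true≢false (sym h))
reach⇒path {G = G} {u = u} {v} (suc k) h with ∨-true (reachB G k u v) h
... | inj₁ h₁ = reach⇒path k h₁
... | inj₂ h₂ with anyFin-witness (λ x → reachB G k u x ∧ adj G x v) h₂
...   | w , hw with ∧-true _ _ hw
...     | u⇝w , w~v = reach⇒path k u⇝w ◅◅ adjacent w~v ◅ ε

reach-◅ : ∀ k → Adj G u w → reachB G k w v ≡ true → reachB G (suc k) u v ≡ true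
reach-◅ {G = G} {u = u} {w} {v} zero (adjacent u~w) h with w ≟ v
... | yes refl = ∨-trueʳ _ (anyFin-intro (λ x → ⌊ u ≟ x ⌋ ∧ adj G x w) u (cong₂ _∧_ (≟-refl u) u~w))
... | no _     = ⊥-elim (true≢false (sym h))
reach-◅ {G = G} {u = u} {w} {v} (suc k) u~w h with ∨-true (reachB G k w v) h
... | inj₁ h₁ = ∨-trueˡ _ (reach-◅ k u~w h₁)
... | inj₂ h₂ with anyFin-witness (λ y → reachB G k w y ∧ adj G y v) h₂
...   | x , hx with ∧-true _ _ hx
...     | w⇝x , x~v =
  ∨-trueʳ _ (anyFin-intro (λ y → reachB G (suc k) u y ∧ adj G y v) x (cong₂ _∧_ (reach-◅ k u~w w⇝x) x~v))

path⇒reach : Path G u v → ∃ λ k → reachB G k u v ≡ true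
path⇒reach {u = u} ε = 0 , ≟-refl u
path⇒reach (u~w ◅ w⇝v) with path⇒reach w⇝v
... | k , h = suc k , reach-◅ k u~w h

reach-mono : k ≤ l → reachB G k u v ≡ true → reachB G l u v ≡ true
reach-mono = go ∘ ℕ.≤⇒≤′
  where
  go : k ≤′ l → reachB G k u v ≡ true → reachB G l u v ≡ true
  go ≤′-refl       h = h
  go (≤′-step k≤l) h = ∨-trueˡ _ (go k≤l h)

Stable : EdgeSet m → Fin m → ℕ → Set
Stable {m} G u j = ∀ (v : Fin m) → reachB G (suc j) u v ≡ reachB G j u v

stable-suc : ∀ {j} → Stable G u j → Stable G u (suc j)
stable-suc {G = G} {u = u} {j} st v = begin
    reachB G (suc j) u v ∨ anyFin (λ w → reachB G (suc j) u w ∧ adj G w v)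
  ≡⟨ cong (reachB G (suc j) u v ∨_) (anyFin-cong λ w → cong (_∧ adj G w v) (st w)) ⟩
    (reachB G j u v ∨ new) ∨ new
  ≡⟨ Bool.∨-assoc (reachB G j u v) new new ⟩
    reachB G j u v ∨ (new ∨ new)
  ≡⟨ cong (reachB G j u v ∨_) (Bool.∨-idem new) ⟩
    reachB G j u v ∨ new ∎
  where
  open ≡-Reasoning
  new : Bool
  new = anyFin (λ w → reachB G j u w ∧ adj G w v)

stable-≤′ : ∀ {j} → Stable G u j → j ≤′ k → Stable G u k
stable-≤′ st ≤′-refl       = st
stable-≤′ {u = u} st (≤′-step {n = k} j≤k) = stable-suc {u = u} {j = k} (stable-≤′ st j≤k)

stable-collapse : ∀ {j} → Stable G u j → j ≤′ k → ∀ v → reachB G k u v ≡ reachB G j u v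
stable-collapse st ≤′-refl       v = refl
stable-collapse st (≤′-step j≤k) v = trans (stable-≤′ st j≤k v) (stable-collapse st j≤k v)

grows-or-stabilises : (G : EdgeSet m) (u : Fin m) → ∀ k →
  suc k ≤ countFin (reachB G k u) ⊎ ∃ λ j → j ≤ k × Stable G u j
grows-or-stabilises G u zero = inj₁ (countFin-pos (reachB G zero u) u (≟-refl u))
grows-or-stabilises {m} G u (suc k) with grows-or-stabilises G u k
... | inj₂ (j , j≤k , st) = inj₂ (j , ℕ.m≤n⇒m≤1+n j≤k , st)
... | inj₁ grown with all? (λ v → reachB G (suc k) u v Bool.≟ reachB G k u v)
...   | yes st = inj₂ (k , ℕ.n≤1+n k , st)
...   | no ¬st with ¬∀⟶∃¬ m _ (λ v → reachB G (suc k) u v Bool.≟ reachB G k u v) ¬st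
...     | v , changed = inj₁ (ℕ.<-≤-trans (s≤s grown) (countFin-mono-< (λ _ → ∨-trueˡ _) v old new))
  where
  old : reachB G k u v ≡ false
  old = Bool.¬-not λ h → changed (trans (∨-trueˡ _ h) (sym h))
  new : reachB G (suc k) u v ≡ true
  new = Bool.¬-not λ h → changed (trans h (sym old))

stabilises : (G : EdgeSet m) (u : Fin m) → ∃ λ j → j ≤ m × Stable G u j
stabilises {m} G u with grows-or-stabilises G u m
... | inj₂ stable = stable
... | inj₁ grown  = ⊥-elim (ℕ.n≮n m (ℕ.≤-trans grown (countFin-bound _)))

reach⇒connB : ∀ k → reachB G k u v ≡ true → connB G u v ≡ true
reach⇒connB {G = G} {u = u} {v} k h with stabilises G u
... | j , j≤m , st with ℕ.≤-total k j
...   | inj₁ k≤j = reach-mono (ℕ.≤-trans k≤j j≤m) h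
...   | inj₂ j≤k = reach-mono j≤m (trans (sym (stable-collapse st (ℕ.≤⇒≤′ j≤k) v)) h)

path⇒connB : Path G u v → connB G u v ≡ true
path⇒connB p with path⇒reach p
... | k , h = reach⇒connB k h

connB⇒path : connB G u v ≡ true → Path G u v
connB⇒path {m} = reach⇒path m

connB-trans : connB G u v ≡ true → connB G v w ≡ true → connB G u w ≡ true
connB-trans {G = G} u~v v~w = path⇒connB (connB⇒path {G = G} u~v ◅◅ connB⇒path {G = G} v~w)

connB-sym : connB G u v ≡ true → connB G v u ≡ true
connB-sym {G = G} u~v = path⇒connB (path-sym (connB⇒path {G = G} u~v))

connB-mono : F ⊆E G → connB F u v ≡ true → connB G u v ≡ true
connB-mono {F = F} F⊆G u~v = path⇒connB (path-mono F⊆G (connB⇒path {G = F} u~v))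

-- Rank and flats

nonRoot : EdgeSet m → Fin m → Bool
nonRoot F v = anyFin (λ u → (toℕ u <ᵇ toℕ v) ∧ connB F u v)

nonRoot-witness : nonRoot F v ≡ true → ∃ λ u → u <F v × connB F u v ≡ true
nonRoot-witness {F = F} {v = v} h with anyFin-witness (λ u → (toℕ u <ᵇ toℕ v) ∧ connB F u v) h
... | u , hu with ∧-true (toℕ u <ᵇ toℕ v) _ hu
...   | u<v , u~v = u , ℕ.<ᵇ⇒< (toℕ u) (toℕ v) (Bool.T-≡ .Equivalence.from u<v) , u~v

nonRoot-intro : u <F v → connB F u v ≡ true → nonRoot F v ≡ true
nonRoot-intro {u = u} {v} {F} u<v u~v =
  anyFin-intro (λ x → (toℕ x <ᵇ toℕ v) ∧ connB F x v) u
    (cong₂ _∧_ (Bool.T-≡ .Equivalence.to (ℕ.<⇒<ᵇ u<v)) u~v)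

nonRoot-mono : F ⊆E G → nonRoot F v ≡ true → nonRoot G v ≡ true
nonRoot-mono {F = F} F⊆G h with nonRoot-witness {F = F} h
... | u , u<v , u~v = nonRoot-intro u<v (connB-mono F⊆G u~v)

nonRoot⇒nonIsolated : nonRoot F v ≡ true → nonIsolated F v ≡ true
nonRoot⇒nonIsolated {F = F} {v = v} h with nonRoot-witness {F = F} h
... | u , u<v , u~v with path-sym (connB⇒path {G = F} u~v)
...   | ε = ⊥-elim (ℕ.<-irrefl refl u<v)
...   | _◅_ {j = w} (adjacent v~w) _ = anyFin-intro (adj F v) w v~w

-- Every component of non-isolated vertices has exactly one root, its least vertex, and isolated
-- vertices are roots.
rank≡countNonRoot : (F : EdgeSet m) → rank F ≡ countFin (nonRoot F)
rank≡countNonRoot {m} F = begin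
    countFin (nonIsolated F) ∸ countFin roots
  ≡⟨ cong (_∸ countFin roots) (countFin-split (nonIsolated F) (nonRoot F)) ⟩
    countFin roots N.+ countFin (λ v → nonIsolated F v ∧ nonRoot F v) ∸ countFin roots
  ≡⟨ ℕ.m+n∸m≡n (countFin roots) _ ⟩
    countFin (λ v → nonIsolated F v ∧ nonRoot F v)
  ≡⟨ countFin-cong absorb ⟩
    countFin (nonRoot F) ∎
  where
  open ≡-Reasoning
  roots : Fin m → Bool
  roots v = nonIsolated F v ∧ not (nonRoot F v)
  absorb : ∀ v → nonIsolated F v ∧ nonRoot F v ≡ nonRoot F v
  absorb v with nonRoot F v in eq
  ... | true  = cong (_∧ true) (nonRoot⇒nonIsolated {F = F} eq)
  ... | false = Bool.∧-zeroʳ _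

root : (F : EdgeSet m) (x : Fin m) → ∃ λ r → connB F r x ≡ true × nonRoot F r ≡ false
root F x with least (λ u → connB F u x) x (path⇒connB {G = F} ε)
... | r , r~x , minimal = r , r~x , Bool.¬-not λ h →
  let u , u<r , u~r = nonRoot-witness {F = F} h
  in true≢false (trans (sym (connB-trans {G = F} u~r r~x)) (minimal u u<r))

⊆-insert : (e : Edge m) → F ⊆E insertE e F
⊆-insert e _ h = ∨-trueˡ _ h

adj-insert : (e : Edge m) → Adj (insertE e F) u v → Adj F u v ⊎ Joins e u v
adj-insert {F = F} e@(a , b , _) u~v with adj⇒edge u~v
... | e′@(i , j , _) , e′∈ , joins with ∨-true (F e′) e′∈
...   | inj₁ e′∈F = inj₁ (edge⇒adj e′ e′∈F joins)
...   | inj₂ same with ∧-true _ _ same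
...     | i≡a , j≡b with ≟⇒≡ i a i≡a | ≟⇒≡ j b j≡b
...       | refl | refl = inj₂ joins

connB-insert : (p : a <F b) → connB F a b ≡ true → ∀ u v → connB (insertE (a , b , p) F) u v ≡ connB F u v
connB-insert {m} {a} {b} {F} p a~b u v =
  ⇔⇒≡ (λ h → path⇒connB (connB⇒path {G = insertE e F} h >>= step)) (connB-mono (⊆-insert e))
  where
  e : Edge m
  e = (a , b , p)
  step : ∀ {x y} → Adj (insertE e F) x y → Path F x y
  step x~y with adj-insert e x~y
  ... | inj₁ x~y′ = x~y′ ◅ ε
  ... | inj₂ joins = path-along e joins (connB⇒path {G = F} a~b)

rank-insert-connected : (p : a <F b) → connB F a b ≡ true → rank (insertE (a , b , p) F) ≡ rank F
rank-insert-connected {a = a} {b} {F} p a~b = begin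
    rank (insertE (a , b , p) F)
  ≡⟨ rank≡countNonRoot (insertE (a , b , p) F) ⟩
    countFin (nonRoot (insertE (a , b , p) F))
  ≡⟨ countFin-cong (λ v → anyFin-cong λ u → cong ((toℕ u <ᵇ toℕ v) ∧_) (connB-insert p a~b u v)) ⟩
    countFin (nonRoot F)
  ≡⟨ rank≡countNonRoot F ⟨
    rank F ∎
  where open ≡-Reasoning

-- The larger of the roots of the components of a and b stops being a root once ab is added.
rank-insert-disconnected : (p : a <F b) → connB F a b ≡ false → rank F < rank (insertE (a , b , p) F)
rank-insert-disconnected {m} {a} {b} {F} p a≁b with root F a | root F b
... | ra , ra~a , ra-root | rb , rb~b , rb-root =
  subst₂ _<_ (sym (rank≡countNonRoot F)) (sym (rank≡countNonRoot F′)) more-nonRoots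
  where
  F′ : EdgeSet m
  F′ = insertE (a , b , p) F
  ra~rb : Path F′ ra rb
  ra~rb = path-mono (⊆-insert (a , b , p)) (connB⇒path {G = F} ra~a)
       ◅◅ edge⇒adj (a , b , p) (∨-trueʳ (F (a , b , p)) (cong₂ _∧_ (≟-refl a) (≟-refl b))) (inj₁ (refl , refl))
       ◅  path-mono (⊆-insert (a , b , p)) (path-sym (connB⇒path {G = F} rb~b))
  loses-root : ∀ {r s} → nonRoot F r ≡ false → s <F r → Path F′ s r →
    countFin (nonRoot F) < countFin (nonRoot F′)
  loses-root {r} r-root s<r s~r =
    countFin-mono-< (λ x → nonRoot-mono {F = F} {v = x} (⊆-insert (a , b , p))) r r-root
      (nonRoot-intro s<r (path⇒connB s~r))
  more-nonRoots : countFin (nonRoot F) < countFin (nonRoot F′)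
  more-nonRoots with <-cmp ra rb
  ... | tri< ra<rb _ _ = loses-root rb-root ra<rb ra~rb
  ... | tri> _ _ rb<ra = loses-root ra-root rb<ra (path-sym ra~rb)
  ... | tri≈ _ refl _  = ⊥-elim (true≢false (trans (sym (connB-trans {G = F} (connB-sym {G = F} ra~a) rb~b)) a≁b))

closure : EdgeSet m → EdgeSet m
closure F (a , b , _) = connB F a b

flat⇒closed : IsFlat G F → ∀ e → e ∈E G → e ∈E closure F → e ∈E F
flat⇒closed {F = F} (_ , rank-grows) e@(a , b , p) e∈G e∈clF with F e in e∉F
... | true  = refl
... | false = ⊥-elim (ℕ.<-irrefl (sym (rank-insert-connected p e∈clF)) (rank-grows e e∈G e∉F))

closed⇒flat : F ⊆E G → (∀ e → e ∈E G → e ∈E closure F → e ∈E F) → IsFlat G F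
closed⇒flat {F = F} F⊆G closed = F⊆G , λ { e@(a , b , p) e∈G e∉F →
  rank-insert-disconnected p (Bool.¬-not λ e∈clF → true≢false (trans (sym (closed e e∈G e∈clF)) e∉F)) }

⊆-closure : F ⊆E closure F
⊆-closure {F = F} (a , b , p) a~b = path⇒connB {G = F} (adjacent (trans (adj-< p) a~b) ◅ ε)

closure-mono : F ⊆E G → closure F ⊆E closure G
closure-mono F⊆G (_ , _ , _) = connB-mono F⊆G

closure-isFlat : IsFlat allEdges (closure F)
closure-isFlat {F = F} = closed⇒flat (λ _ _ → refl) λ { (a , b , p) _ a~b →
  path⇒connB (connB⇒path {G = closure F} a~b >>= step) }
  where
  step : ∀ {x y} → Adj (closure F) x y → Path F x y
  step x~y with adj⇒edge x~y
  ... | e@(_ , _ , _) , e∈clF , joins = path-along e joins (connB⇒path {G = F} e∈clF)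

closure-on-flat : IsFlat Γ F → ∀ e → e ∈E Γ → closure F e ≡ F e
closure-on-flat flat e e∈Γ = ⇔⇒≡ (flat⇒closed flat e e∈Γ) (⊆-closure e)

noEdges-isFlat : IsFlat G noEdges
noEdges-isFlat = closed⇒flat (λ _ ()) λ { (a , b , p) _ a~b →
  ⊥-elim (ℕ.<-irrefl (cong toℕ (trivial (connB⇒path {G = noEdges} a~b))) p) }
  where
  trivial : Path noEdges u v → u ≡ v
  trivial ε = refl
  trivial (u~w ◅ _) with adj⇒edge u~w
  ... | _ , () , _

-- Lifting chains of flats of Γ to K_m

⊆-⊊-trans : F ⊆E G → G ⊊E H → F ⊊E H
⊆-⊊-trans F⊆G (G⊆H , e , e∈H , e∉G) =
  (λ e′ → G⊆H e′ ∘ F⊆G e′) , e , e∈H , Bool.¬-not λ e∈F → true≢false (trans (sym (F⊆G e e∈F)) e∉G)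

⊊-⊆-trans : F ⊊E G → G ⊆E H → F ⊊E H
⊊-⊆-trans (F⊆G , e , e∈G , e∉F) G⊆H = (λ e′ → G⊆H e′ ∘ F⊆G e′) , e , G⊆H e e∈G , e∉F

closure-⊊ : IsFlat Γ F → F ⊊E G → G ⊆E Γ → closure F ⊊E closure G
closure-⊊ flat (F⊆G , e , e∈G , e∉F) G⊆Γ =
  closure-mono F⊆G , e , ⊆-closure e e∈G , trans (closure-on-flat flat e (G⊆Γ e e∈G)) e∉F

closure-chain : (Γ : EdgeSet m) {prev prev′ : EdgeSet m} (cs : List (ℚ × EdgeSet m)) →
  prev′ ⊆E closure prev → IsFlat Γ prev → ChainFrom Γ prev (map proj₂ cs) →
  ChainFrom allEdges prev′ (map proj₂ (map (map₂ closure) cs))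
closure-chain Γ []             _   _        _ = tt
closure-chain Γ ((_ , F) ∷ cs) sub flatPrev (prev⊊F , flatF , F⊊Γ , chain) =
  ⊆-⊊-trans sub (closure-⊊ flatPrev prev⊊F (proj₁ F⊊Γ)) ,
  closure-isFlat ,
  ⊊-⊆-trans (closure-⊊ flatF F⊊Γ (λ _ e∈Γ → e∈Γ)) (λ _ _ → refl) ,
  closure-chain Γ cs (λ _ e∈ → e∈) flatF chain

chain-flats : ∀ {prev} (cs : List (ℚ × EdgeSet m)) → ChainFrom Γ prev (map proj₂ cs) →
  All (IsFlat Γ ∘ proj₂) cs
chain-flats []       _                     = []
chain-flats (_ ∷ cs) (_ , flat , _ , chain) = flat ∷ chain-flats cs chain

ρ-cong : (F G : EdgeSet m) (e : Edge m) → F e ≡ G e → ρ F e ≡ ρ G e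
ρ-cong _ _ _ eq = cong (λ b → if b then - 1ℚ else 0ℚ) eq

combo-map₂ : (f : EdgeSet m → EdgeSet m) (e : Edge m) (cs : List (ℚ × EdgeSet m)) →
  All (λ c → f (proj₂ c) e ≡ proj₂ c e) cs → combo (map (map₂ f) cs) e ≡ combo cs e
combo-map₂ f e []             []       = refl
combo-map₂ f e ((l , F) ∷ cs) (eq ∷ eqs) = cong₂ _+_ (cong (l *_) (ρ-cong (f F) F e eq)) (combo-map₂ f e cs eqs)

shift : ∀ {x y c : ℚ} → x ≡ y + c → y ≡ x + - c
shift {x} {y} {c} x≡y+c = sym (begin
  x + - c       ≡⟨ cong (_+ - c) x≡y+c ⟩
  y + c + - c   ≡⟨ ℚ.+-assoc y c (- c) ⟩
  y + (c + - c) ≡⟨ cong (y +_) (ℚ.+-inverseʳ c) ⟩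
  y + 0ℚ        ≡⟨ ℚ.+-identityʳ y ⟩
  y             ∎)
  where open ≡-Reasoning

B'⊆projection : (Γ : EdgeSet m) (y : Vec m) → InB' Γ y → InProjection Γ y
B'⊆projection {m} Γ y (cs , chain , nonneg , c , y≡) =
  combo ds ,
  (ds , closure-chain Γ cs (λ _ ()) noEdges-isFlat chain , map⁺ nonneg , 0ℚ , λ e _ → sym (ℚ.+-identityʳ _)) ,
  - c , λ e e∈Γ → trans (closed-combo e e∈Γ) (shift (y≡ e e∈Γ))
  where
  ds : List (ℚ × EdgeSet m)
  ds = map (map₂ closure) cs
  closed-combo : ∀ e → e ∈E Γ → combo ds e ≡ combo cs e
  closed-combo e e∈Γ = combo-map₂ closure e cs (All.map (λ flat → closure-on-flat flat e e∈Γ) (chain-flats cs chain))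

-- Restricting chains of flats of K_m to Γ

_∩E_ : EdgeSet m → EdgeSet m → EdgeSet m
(F ∩E G) e = F e ∧ G e

∩-⊆ʳ : (F ∩E G) ⊆E G
∩-⊆ʳ e = proj₂ ∘ ∧-true _ _

∩-monoˡ : F ⊆E G → (F ∩E H) ⊆E (G ∩E H)
∩-monoˡ F⊆G e e∈ = let e∈F , e∈H = ∧-true _ _ e∈ in cong₂ _∧_ (F⊆G e e∈F) e∈H

∩-isFlat : Γ ⊆E H → IsFlat H F → IsFlat Γ (F ∩E Γ)
∩-isFlat {F = F} Γ⊆H flat = closed⇒flat (∩-⊆ʳ {F = F}) λ e e∈Γ e∈cl →
  cong₂ _∧_ (flat⇒closed flat e (Γ⊆H e e∈Γ) (closure-mono (λ e′ → proj₁ ∘ ∧-true (F e′) _) e e∈cl)) e∈Γ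

-- If Γ ⊆ F, connectedness of Γ puts every edge of H into the closure of F, hence into F.
∩-proper : Connected Γ → IsFlat H F → F ⊊E H → (F ∩E Γ) ⊊E Γ
∩-proper {Γ = Γ} {F = F} connected flat (_ , e@(a , b , _) , e∈H , e∉F)
  with any-edge? (λ e → Γ e ∧ not (F e))
... | yes (e′ , h) = let e′∈Γ , e′∉F = ∧-true (Γ e′) _ h in
  ∩-⊆ʳ {F = F} , e′ , e′∈Γ , cong (_∧ Γ e′) (Bool.not-injective e′∉F)
... | no Γ⊈F = ⊥-elim (true≢false (trans (sym (flat⇒closed flat e e∈H a~b)) e∉F))
  where
  Γ⊆F : Γ ⊆E F
  Γ⊆F e e∈Γ = Bool.¬-not λ e∉F → Γ⊈F (e , cong₂ _∧_ e∈Γ (cong not e∉F))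
  a~b : connB F a b ≡ true
  a~b = path⇒connB (path-mono Γ⊆F (connected⇒path connected a b))

NonNeg : List (ℚ × EdgeSet m) → Set
NonNeg = All (λ c → 0ℚ ≤ℚ proj₁ c)

WeakChain : EdgeSet m → EdgeSet m → List (ℚ × EdgeSet m) → Set
WeakChain Γ prev []             = ⊤
WeakChain Γ prev ((l , F) ∷ cs) = prev ⊆E F × IsFlat Γ F × F ⊊E Γ × 0ℚ ≤ℚ l × WeakChain Γ F cs

ChainCombination : EdgeSet m → EdgeSet m → Vec m → Set
ChainCombination {m} Γ prev x =
  Σ[ ds ∈ List (ℚ × EdgeSet m) ] ChainFrom Γ prev (map proj₂ ds) × NonNeg ds × (∀ e → combo ds e ≡ x e)

∩-chain : Γ ⊆E H → Connected Γ → ∀ {prev} (cs : List (ℚ × EdgeSet m)) →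
  ChainFrom H prev (map proj₂ cs) → NonNeg cs → WeakChain Γ (prev ∩E Γ) (map (map₂ (_∩E Γ)) cs)
∩-chain Γ⊆H connected []             _                                   _              = tt
∩-chain Γ⊆H connected ((_ , F) ∷ cs) ((prev⊆F , _) , flat , F⊊H , chain) (l≥0 ∷ nonneg) =
  ∩-monoˡ prev⊆F , ∩-isFlat Γ⊆H flat , ∩-proper connected flat F⊊H , l≥0 , ∩-chain Γ⊆H connected cs chain nonneg

merge-coefficients : ∀ {l l′ a a′ r : ℚ} → a′ ≡ a → (l + l′) * a′ + r ≡ l * a + (l′ * a′ + r)
merge-coefficients {l} {l′} {a} {a′} {r} a′≡a = begin
  (l + l′) * a′ + r         ≡⟨ cong (_+ r) (ℚ.*-distribʳ-+ a′ l l′) ⟩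
  l * a′ + l′ * a′ + r      ≡⟨ ℚ.+-assoc (l * a′) (l′ * a′) r ⟩
  l * a′ + (l′ * a′ + r)    ≡⟨ cong (λ z → l * z + (l′ * a′ + r)) a′≡a ⟩
  l * a + (l′ * a′ + r)     ∎
  where open ≡-Reasoning

-- l ρ_G is a pending term: the leading flats of cs equal to G are absorbed into it.
merge : ∀ {prev} l G (cs : List (ℚ × EdgeSet m)) → prev ⊊E G → IsFlat Γ G → G ⊊E Γ → 0ℚ ≤ℚ l →
  WeakChain Γ G cs → ChainCombination Γ prev (λ e → l * ρ G e + combo cs e)
merge l G [] prev⊊G flat G⊊Γ l≥0 _ = ((l , G) ∷ []) , (prev⊊G , flat , G⊊Γ , tt) , l≥0 ∷ [] , λ _ → refl
merge l G ((l′ , H) ∷ cs) prev⊊G flatG G⊊Γ l≥0 (G⊆H , flatH , H⊊Γ , l′≥0 , weak)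
  with any-edge? (λ e → H e ∧ not (G e))
... | yes (e , h) =
  let e∈H , e∉G = ∧-true (H e) _ h
      ds , chain , nonneg , ds≗ = merge l′ H cs (G⊆H , e , e∈H , Bool.not-injective e∉G) flatH H⊊Γ l′≥0 weak
  in  ((l , G) ∷ ds) , (prev⊊G , flatG , G⊊Γ , chain) , l≥0 ∷ nonneg , λ e → cong (l * ρ G e +_) (ds≗ e)
... | no H⊈G =
  let ds , chain , nonneg , ds≗ = merge (l + l′) H cs (⊊-⊆-trans prev⊊G G⊆H) flatH H⊊Γ (ℚ.+-mono-≤ l≥0 l′≥0) weak
  in  ds , chain , nonneg , λ e → trans (ds≗ e) (merge-coefficients {l} {l′} {r = combo cs e} (ρ-cong H G e (H≗G e)))
  where
  H≗G : ∀ e → H e ≡ G e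
  H≗G e = ⇔⇒≡ (λ e∈H → Bool.¬-not λ e∉G → H⊈G (e , cong₂ _∧_ e∈H (cong not e∉G))) (G⊆H e)

strictify : ∀ {prev} (cs : List (ℚ × EdgeSet m)) → WeakChain Γ prev cs → ChainCombination Γ noEdges (combo cs)
strictify []             _ = [] , tt , [] , λ _ → refl
strictify ((l , F) ∷ cs) (_ , flat , F⊊Γ , l≥0 , weak) with any-edge? F
... | yes (e , e∈F) = merge l F cs ((λ _ ()) , e , e∈F , refl) flat F⊊Γ l≥0 weak
... | no F≢∅ =
  let ds , chain , nonneg , ds≗ = strictify cs weak
  in  ds , chain , nonneg , λ e → trans (ds≗ e) (sym (drop-empty e))
  where
  drop-empty : ∀ e → l * ρ F e + combo cs e ≡ combo cs e
  drop-empty e = begin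
    l * ρ F e + combo cs e  ≡⟨ cong (λ z → l * z + combo cs e) (ρ-cong F noEdges e (Bool.¬-not λ e∈F → F≢∅ (e , e∈F))) ⟩
    l * 0ℚ + combo cs e     ≡⟨ cong (_+ combo cs e) (ℚ.*-zeroʳ l) ⟩
    0ℚ + combo cs e         ≡⟨ ℚ.+-identityˡ (combo cs e) ⟩
    combo cs e              ∎
    where open ≡-Reasoning

projection⊆B' : (Γ : EdgeSet m) → Connected Γ → (y : Vec m) → InProjection Γ y → InB' Γ y
projection⊆B' Γ connected y (x , (cs , chain , nonneg , c , x≡) , c′ , x≡y)
  with strictify (map (map₂ (_∩E Γ)) cs) (∩-chain (λ _ _ → refl) connected cs chain nonneg)
... | ds , chain′ , nonneg′ , ds≗ = ds , chain′ , nonneg′ , c + - c′ , λ e e∈Γ → begin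
    y e                      ≡⟨ shift (x≡y e e∈Γ) ⟩
    x e + - c′               ≡⟨ cong (_+ - c′) (x≡ e refl) ⟩
    combo cs e + c + - c′    ≡⟨ cong (λ z → z + c + - c′) (restricted-combo e e∈Γ) ⟨
    combo ds e + c + - c′    ≡⟨ ℚ.+-assoc (combo ds e) c (- c′) ⟩
    combo ds e + (c + - c′)  ∎
  where
  open ≡-Reasoning
  restricted-combo : ∀ e → e ∈E Γ → combo ds e ≡ combo cs e
  restricted-combo e e∈Γ = trans (ds≗ e) (combo-map₂ (_∩E Γ) e cs
    (All.universal (λ (_ , F) → trans (cong (F e ∧_) e∈Γ) (Bool.∧-identityʳ (F e))) cs))

theorem3p21 : (n : ℕ) → 4 ≤ n → (Γ : EdgeSet (n ∸ 1)) → Connected Γ →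
    (y : Vec (n ∸ 1)) → (InProjection Γ y → InB' Γ y) × (InB' Γ y → InProjection Γ y)
theorem3p21 n _ Γ connected y = projection⊆B' Γ connected y , B'⊆projection Γ y
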